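{- Let $n\ge 3$ be an odd integer. Then for all $m\in\{3,\dots,n-1\}$ with $\gcd(m,n)=1$ and $m\neq (n+1)/2$, we have $S(2,n)>S(m,n)$.
   Context: For integers $m,n$ with $n\neq 0$ and $\gcd(m,n)=1$, the Dedekind sum is $s(m,n)=\sum_{j=1}^{|n|}((j/n))((mj/n))$, where $((t))=t-\lfloor t\rfloor-1/2$ for $t\in\mathbb{R}\setminus\mathbb{Z}$ and $((t))=0$ for $t\in\mathbb{Z}$. Define the normalized Dedekind sum $S(m,n)=12\,s(m,n)$. -}

module Defs where

open import Data.Nat as ℕ using (ℕ; zero; suc; NonZero)
open import Data.Nat.DivMod using (_%_)
open import Data.Integer using (+_)
open import Data.Rational using (ℚ; _/_; _+_; _-_; _*_; ½; 0ℚ)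
open import Data.List using (List; map; sum; foldr)
open import Data.List using (upTo)

-- Sawtooth function evaluated at the rational a/n (a ≥ 0, n ≥ 1):
-- ((a/n)) = a/n - ⌊a/n⌋ - 1/2 = (a mod n)/n - 1/2 if n ∤ a, and 0 if n ∣ a.
saw : (a n : ℕ) → .{{_ : NonZero n}} → ℚ
saw a n with a % n
... | zero = 0ℚ
... | suc r = (+ suc r) / n - ½

sumℚ : List ℚ → ℚ
sumℚ = foldr _+_ 0ℚ

dedekind : (m n : ℕ) → .{{_ : NonZero n}} → ℚ
dedekind m n = sumℚ (map (λ i → saw (suc i) n * saw (m ℕ.* suc i) n) (upTo n))

S : (m n : ℕ) → .{{_ : NonZero n}} → ℚ
S m n = (+ 12 / 1) * dedekind m n

-- Write x j = ((j/n)) and y j = ((m j/n)). Since 2 x y = x² + y² − (x − y)² and j ↦ m j mod n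
-- permutes the residues, s(m,n) = Σ_j ((j/n))² − D(m)/(2n²) with D(m) = Σ_{j<n} |j − (m j mod n)|²,
-- so S(2,n) > S(m,n) amounts to D(2) < D(m), a statement about natural numbers.
-- With ‖x‖ = min(x, n − x) we have D(2) = Σ_j ‖j‖², and since m j ≡ j + (m − 1) j the j-th term
-- of D(m) is at least ‖(m − 1) j mod n‖². If m − 1 is prime to n these bounds sum to D(2), and one
-- of them is strict: at j = 1 if 2m > n + 1 and at j = ⌊n/m⌋ if 2m < n + 1. If g = gcd(m − 1, n) > 1
-- and n = g N, the bounds only sum to g³ C with 12 C = N³ − N, which is (g² − 1) n short of
-- 12 D(2) = n³ − n; but in the top third of the g blocks of N consecutive indices, the index j with
-- (m − 1) j ≡ g (N − 1)/2 wraps around n and gains g n, which makes up the difference.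

module Submission where

open import Algebra.Bundles using (CommutativeMonoid)
open import Algebra.Core using (Op₂)
open import Algebra.Structures using (IsCommutativeMonoid)
import Algebra.Properties.CommutativeMonoid.Sum as FinSum
import Algebra.Properties.CommutativeSemigroup as CommutativeSemigroupProperties
open import Data.Fin using (Fin; toℕ; fromℕ<)
open import Data.Fin.Permutation using (Permutation; permutation; _⟨$⟩ʳ_)
open import Data.Fin.Properties using (toℕ-fromℕ<; toℕ-injective; toℕ<n)
import Data.Integer as ℤ
import Data.Integer.Properties as ℤP
import Data.Integer.Tactic.RingSolver as ℤ-Solver
open import Data.List using (foldr; map; upTo; applyUpTo)
open import Data.Nat
open import Data.Nat.Coprimality as Coprimality using (gcd≡1⇒coprime; coprime⇒gcd≡1; coprime-divisor)
open import Data.Nat.Divisibility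
  using (_∣_; _∤_; divides; ∣-refl; ∣-trans; ∣⇒≤; ∣1⇒≡1; 0∣⇒≡0; ∣m+n∣m⇒∣n; m%n≡0⇒n∣m)
open import Data.Nat.DivMod
open import Data.Nat.GCD
  using (gcd; GCD; gcd-GCD; gcd-greatest; gcd[m,n]∣m; gcd[m,n]∣n; c*gcd[m,n]≡gcd[cm,cn]; module Bézout)
open import Data.Nat.Properties
open import Data.Nat.Tactic.RingSolver using (solve-∀)
open import Data.Product using (∃-syntax; _,_; _×_; proj₁; proj₂)
open import Data.Rational as ℚ using (ℚ; ½; 0ℚ; toℚᵘ) renaming (_<_ to _<ℚ_)
import Data.Rational.Properties as ℚP
open import Data.Rational.Solver using (module +-*-Solver)
open import Data.Rational.Unnormalised as ℚᵘ using (mkℚᵘ; *≡*; *<*)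
import Data.Rational.Unnormalised.Properties as ℚᵘP
open import Data.Sum using (inj₁; inj₂)
open import Function using (_∘_)
open import Relation.Binary.PropositionalEquality
open import Relation.Nullary using (yes; no; ¬_; contradiction)

open import Defs

%-inverse : ∀ v N .{{_ : NonZero N}} → gcd v N ≡ 1 → ∃[ w ] (v * w) % N ≡ 1 % N
%-inverse v N@(suc N₀) gcd≡1 with Bézout.identity (subst (GCD v N) gcd≡1 (gcd-GCD v N))
... | Bézout.Identity.+- x y eq = x , (begin
  (v * x) % N     ≡⟨ cong (_% N) (trans (*-comm v x) (sym eq)) ⟩
  (1 + y * N) % N ≡⟨ [m+kn]%n≡m%n 1 y N ⟩
  1 % N           ∎)
  where open ≡-Reasoning
... | Bézout.Identity.-+ x y eq = x * N₀ , (begin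
  (v * (x * N₀)) % N         ≡⟨ [m+n]%n≡m%n (v * (x * N₀)) N ⟨
  (v * (x * N₀) + N) % N     ≡⟨ cong (_% N) (expand v x N₀) ⟩
  (1 + (1 + x * v) * N₀) % N ≡⟨ cong (λ z → (1 + z * N₀) % N) eq ⟩
  (1 + (y * N) * N₀) % N     ≡⟨ cong (λ z → (1 + z) % N) (swap y N N₀) ⟩
  (1 + (y * N₀) * N) % N     ≡⟨ [m+kn]%n≡m%n 1 (y * N₀) N ⟩
  1 % N                      ∎)
  where
  open ≡-Reasoning
  expand : ∀ v x N₀ → v * (x * N₀) + suc N₀ ≡ 1 + (1 + x * v) * N₀
  expand = solve-∀
  swap : ∀ y N N₀ → (y * N) * N₀ ≡ (y * N₀) * N
  swap = solve-∀

*-%-inverse : ∀ {v w} y N .{{_ : NonZero N}} → (v * w) % N ≡ 1 % N → y < N →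
              (v * ((w * y) % N)) % N ≡ y
*-%-inverse {v} {w} y N vw≡1 y<N = begin
  (v * ((w * y) % N)) % N           ≡⟨ %-distribˡ-* v ((w * y) % N) N ⟩
  ((v % N) * ((w * y) % N % N)) % N ≡⟨ cong (λ z → ((v % N) * z) % N) (m%n%n≡m%n (w * y) N) ⟩
  ((v % N) * ((w * y) % N)) % N     ≡⟨ %-distribˡ-* v (w * y) N ⟨
  (v * (w * y)) % N                 ≡⟨ cong (_% N) (*-assoc v w y) ⟨
  ((v * w) * y) % N                 ≡⟨ %-distribˡ-* (v * w) y N ⟩
  (((v * w) % N) * (y % N)) % N     ≡⟨ cong (λ z → (z * (y % N)) % N) vw≡1 ⟩
  ((1 % N) * (y % N)) % N           ≡⟨ %-distribˡ-* 1 y N ⟨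
  (1 * y) % N                       ≡⟨ cong (_% N) (*-identityˡ y) ⟩
  y % N                             ≡⟨ m<n⇒m%n≡m y<N ⟩
  y                                 ∎
  where open ≡-Reasoning

module RangeSum {A : Set} {_∙_ : Op₂ A} {ε : A} (isCM : IsCommutativeMonoid _≡_ _∙_ ε) where
  open IsCommutativeMonoid isCM using (assoc; comm; identityˡ; identityʳ)
  private
    M : CommutativeMonoid _ _
    M = record { isCommutativeMonoid = isCM }
    module F = FinSum M
  open CommutativeSemigroupProperties (CommutativeMonoid.commutativeSemigroup M) using (interchange)

  ∑ : ℕ → (ℕ → A) → A
  ∑ zero    f = ε
  ∑ (suc n) f = f 0 ∙ ∑ n (f ∘ suc)

  ∑-cong : ∀ n {f g : ℕ → A} → (∀ i → i < n → f i ≡ g i) → ∑ n f ≡ ∑ n g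
  ∑-cong zero    f≡g = refl
  ∑-cong (suc n) f≡g = cong₂ _∙_ (f≡g 0 z<s) (∑-cong n (λ i i<n → f≡g (suc i) (s<s i<n)))

  ∑-split : ∀ a b (f : ℕ → A) → ∑ (a + b) f ≡ ∑ a f ∙ ∑ b (λ i → f (a + i))
  ∑-split zero    b f = sym (identityˡ _)
  ∑-split (suc a) b f = trans (cong (f 0 ∙_) (∑-split a b (f ∘ suc))) (sym (assoc _ _ _))

  ∑-last : ∀ n (f : ℕ → A) → ∑ (suc n) f ≡ ∑ n f ∙ f n
  ∑-last n f = begin
    ∑ (suc n) f             ≡⟨ cong (λ k → ∑ k f) (+-comm 1 n) ⟩
    ∑ (n + 1) f             ≡⟨ ∑-split n 1 f ⟩
    ∑ n f ∙ (f (n + 0) ∙ ε) ≡⟨ cong (∑ n f ∙_) (trans (identityʳ _) (cong f (+-identityʳ n))) ⟩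
    ∑ n f ∙ f n             ∎
    where open ≡-Reasoning

  ∑-rotate : ∀ n (f : ℕ → A) → f n ≡ f 0 → ∑ n (f ∘ suc) ≡ ∑ n f
  ∑-rotate zero    f _     = refl
  ∑-rotate (suc n) f fn≡f0 = begin
    ∑ (suc n) (f ∘ suc)       ≡⟨ ∑-last n (f ∘ suc) ⟩
    ∑ n (f ∘ suc) ∙ f (suc n) ≡⟨ cong (∑ n (f ∘ suc) ∙_) fn≡f0 ⟩
    ∑ n (f ∘ suc) ∙ f 0       ≡⟨ comm _ _ ⟩
    ∑ (suc n) f               ∎
    where open ≡-Reasoning

  ∑-∙ : ∀ n (f g : ℕ → A) → ∑ n (λ i → f i ∙ g i) ≡ ∑ n f ∙ ∑ n g
  ∑-∙ zero    f g = sym (identityˡ ε)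
  ∑-∙ (suc n) f g = trans (cong ((f 0 ∙ g 0) ∙_) (∑-∙ n (f ∘ suc) (g ∘ suc)))
                          (interchange (f 0) (g 0) _ _)

  ∑-rows : ∀ g N (f : ℕ → A) → ∑ (g * N) f ≡ ∑ g (λ i → ∑ N (λ r → f (i * N + r)))
  ∑-rows zero    N f = refl
  ∑-rows (suc g) N f = begin
    ∑ (N + g * N) f                                        ≡⟨ ∑-split N (g * N) f ⟩
    ∑ N f ∙ ∑ (g * N) (λ i → f (N + i))                    ≡⟨ cong (∑ N f ∙_) (∑-rows g N (λ i → f (N + i))) ⟩
    ∑ N f ∙ ∑ g (λ i → ∑ N (λ r → f (N + (i * N + r))))    ≡⟨ cong (∑ N f ∙_) (∑-cong g (λ i _ →
                                                                ∑-cong N (λ r _ → cong f (sym (+-assoc N (i * N) r))))) ⟩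
    ∑ N f ∙ ∑ g (λ i → ∑ N (λ r → f (N + i * N + r)))      ∎
    where open ≡-Reasoning

  ∑-upTo : ∀ n (f : ℕ → A) → foldr _∙_ ε (map f (upTo n)) ≡ ∑ n f
  ∑-upTo n f = ∑-applyUpTo n (λ i → i)
    where
    ∑-applyUpTo : ∀ n (h : ℕ → ℕ) → foldr _∙_ ε (map f (applyUpTo h n)) ≡ ∑ n (f ∘ h)
    ∑-applyUpTo zero    h = refl
    ∑-applyUpTo (suc n) h = cong (f (h 0) ∙_) (∑-applyUpTo n (h ∘ suc))

  ∑-Fin : ∀ n (f : ℕ → A) → ∑ n f ≡ F.sum {n} (f ∘ toℕ)
  ∑-Fin zero    f = refl
  ∑-Fin (suc n) f = cong (f 0 ∙_) (∑-Fin n (f ∘ suc))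

  ∑-*%-permute : ∀ N v (f : ℕ → A) .{{_ : NonZero N}} → gcd v N ≡ 1 →
                 ∑ N (λ r → f ((v * r) % N)) ≡ ∑ N f
  ∑-*%-permute N v f gcd≡1 with %-inverse v N gcd≡1
  ... | w , vw≡1 = begin
    ∑ N (λ r → f ((v * r) % N))            ≡⟨ ∑-Fin N _ ⟩
    F.sum {N} (λ i → f ((v * toℕ i) % N))  ≡⟨ F.sum-cong-≗ {N} (λ i → cong f (sym (toℕ-fromℕ< _))) ⟩
    F.sum {N} (λ i → f (toℕ (π ⟨$⟩ʳ i)))   ≡⟨ F.sum-permute (f ∘ toℕ) π ⟨
    F.sum {N} (f ∘ toℕ)                    ≡⟨ ∑-Fin N f ⟨
    ∑ N f                                  ∎
    where
    open ≡-Reasoning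
    wv≡1 : (w * v) % N ≡ 1 % N
    wv≡1 = trans (cong (_% N) (*-comm w v)) vw≡1
    mul : ℕ → Fin N → Fin N
    mul c i = fromℕ< (m%n<n (c * toℕ i) N)
    mul-inverse : ∀ c d → (c * d) % N ≡ 1 % N → ∀ i → mul c (mul d i) ≡ i
    mul-inverse c d cd≡1 i = toℕ-injective (begin
      toℕ (mul c (mul d i))          ≡⟨ toℕ-fromℕ< _ ⟩
      (c * toℕ (mul d i)) % N        ≡⟨ cong (λ z → (c * z) % N) (toℕ-fromℕ< _) ⟩
      (c * ((d * toℕ i) % N)) % N    ≡⟨ *-%-inverse {c} {d} (toℕ i) N cd≡1 (toℕ<n i) ⟩
      toℕ i                          ∎)
    π : Permutation N N
    π = permutation (mul v) (mul w) (mul-inverse v w vw≡1) (mul-inverse w v wv≡1)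

open RangeSum +-0-isCommutativeMonoid

∑-mono-≤ : ∀ n {f g : ℕ → ℕ} → (∀ i → i < n → f i ≤ g i) → ∑ n f ≤ ∑ n g
∑-mono-≤ zero    f≤g = z≤n
∑-mono-≤ (suc n) f≤g = +-mono-≤ (f≤g 0 z<s) (∑-mono-≤ n (λ i i<n → f≤g (suc i) (s<s i<n)))

∑-mono-≤-gain : ∀ n {f g : ℕ → ℕ} {e} w → (∀ i → i < n → f i ≤ g i) → w < n →
                f w + e ≤ g w → ∑ n f + e ≤ ∑ n g
∑-mono-≤-gain (suc n) {f} {g} {e} zero f≤g _ fw+e≤gw = begin
  f 0 + ∑ n (f ∘ suc) + e   ≡⟨ +-assoc (f 0) _ e ⟩
  f 0 + (∑ n (f ∘ suc) + e) ≡⟨ cong (f 0 +_) (+-comm _ e) ⟩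
  f 0 + (e + ∑ n (f ∘ suc)) ≡⟨ +-assoc (f 0) e _ ⟨
  f 0 + e + ∑ n (f ∘ suc)   ≤⟨ +-mono-≤ fw+e≤gw (∑-mono-≤ n (λ i i<n → f≤g (suc i) (s<s i<n))) ⟩
  g 0 + ∑ n (g ∘ suc)       ∎
  where open ≤-Reasoning
∑-mono-≤-gain (suc n) {f} {g} {e} (suc w) f≤g (s<s w<n) fw+e≤gw = begin
  f 0 + ∑ n (f ∘ suc) + e   ≡⟨ +-assoc (f 0) _ e ⟩
  f 0 + (∑ n (f ∘ suc) + e) ≤⟨ +-mono-≤ (f≤g 0 z<s)
                                (∑-mono-≤-gain n w (λ i i<n → f≤g (suc i) (s<s i<n)) w<n fw+e≤gw) ⟩
  g 0 + ∑ n (g ∘ suc)       ∎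
  where open ≤-Reasoning

∑-*ˡ : ∀ n c (f : ℕ → ℕ) → ∑ n (λ i → c * f i) ≡ c * ∑ n f
∑-*ˡ zero    c f = sym (*-zeroʳ c)
∑-*ˡ (suc n) c f = trans (cong (c * f 0 +_) (∑-*ˡ n c (f ∘ suc))) (sym (*-distribˡ-+ c (f 0) _))

∑-const : ∀ n c → ∑ n (λ _ → c) ≡ n * c
∑-const zero    c = refl
∑-const (suc n) c = cong (c +_) (∑-const n c)

-- Squares and the distance to the nearest multiple

infix 8 _²

_² : ℕ → ℕ
x ² = x * x

*-² : ∀ a b → (a * b) ² ≡ a ² * b ²
*-² = expand
  where
  expand : ∀ a b → (a * b) * (a * b) ≡ (a * a) * (b * b)
  expand = solve-∀

²-mono-≤ : ∀ {x y} → x ≤ y → x ² ≤ y ²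
²-mono-≤ x≤y = *-mono-≤ x≤y x≤y

²-mono-< : ∀ {x y} → x < y → x ² < y ²
²-mono-< x<y = *-mono-< x<y x<y

‖_‖⟨_⟩ : ℕ → ℕ → ℕ
‖ x ‖⟨ M ⟩ = x ⊓ (M ∸ x)

x+x≤M⇒‖x‖≡x : ∀ {x M} → x + x ≤ M → ‖ x ‖⟨ M ⟩ ≡ x
x+x≤M⇒‖x‖≡x {x} x+x≤M = m≤n⇒m⊓n≡m (m+n≤o⇒m≤o∸n x x+x≤M)

M≤x+x⇒‖x‖≡M∸x : ∀ {x M} → M ≤ x + x → ‖ x ‖⟨ M ⟩ ≡ M ∸ x
M≤x+x⇒‖x‖≡M∸x {x} M≤x+x = m≥n⇒m⊓n≡n (m≤n+o⇒m∸n≤o _ x M≤x+x)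

2*‖x‖≤M : ∀ {x M} → x ≤ M → 2 * ‖ x ‖⟨ M ⟩ ≤ M
2*‖x‖≤M {x} {M} x≤M = begin
  2 * ‖ x ‖⟨ M ⟩           ≡⟨ cong (‖ x ‖⟨ M ⟩ +_) (+-identityʳ _) ⟩
  ‖ x ‖⟨ M ⟩ + ‖ x ‖⟨ M ⟩  ≤⟨ +-mono-≤ (m⊓n≤m x (M ∸ x)) (m⊓n≤n x (M ∸ x)) ⟩
  x + (M ∸ x)              ≡⟨ m+[n∸m]≡n x≤M ⟩
  M                        ∎
  where open ≤-Reasoning

‖g*x‖⟨g*M⟩≡g*‖x‖ : ∀ g x M → ‖ g * x ‖⟨ g * M ⟩ ≡ g * ‖ x ‖⟨ M ⟩
‖g*x‖⟨g*M⟩≡g*‖x‖ g x M = trans (cong ((g * x) ⊓_) (sym (*-distribˡ-∸ g M x))) (sym (*-distribˡ-⊓ g x (M ∸ x)))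

2*‖u‖≤n<2*d⇒‖u‖²<d² : ∀ {u n d} → u ≤ n → n < 2 * d → ‖ u ‖⟨ n ⟩ ² < d ²
2*‖u‖≤n<2*d⇒‖u‖²<d² {u} {n} {d} u≤n n<2d =
  ²-mono-< {‖ u ‖⟨ n ⟩} {d} (*-cancelˡ-< 2 _ _ (≤-<-trans (2*‖x‖≤M u≤n) n<2d))

-- The squared displacement of j ↦ m j mod n

displacement : (m n : ℕ) .{{_ : NonZero n}} → ℕ
displacement m n = ∑ n (λ j → ∣ j - (m * j) % n ∣ ²)

module _ (n : ℕ) .{{_ : NonZero n}} where

  ∣j-[j+u]%n∣≡u : ∀ {j u} → j + u < n → ∣ j - (j + u) % n ∣ ≡ u
  ∣j-[j+u]%n∣≡u {j} {u} j+u<n = trans (cong ∣ j -_∣ (m<n⇒m%n≡m j+u<n)) (∣m-m+n∣≡n j u)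

  ∣j-[j+u]%n∣≡n∸u : ∀ {j u} → j < n → u ≤ n → n ≤ j + u → ∣ j - (j + u) % n ∣ ≡ n ∸ u
  ∣j-[j+u]%n∣≡n∸u {j} {u} j<n u≤n n≤j+u = begin
    ∣ j - s ∣               ≡⟨ cong ∣_- s ∣ j≡s+[n∸u] ⟩
    ∣ s + (n ∸ u) - s ∣     ≡⟨ ∣-∣-comm (s + (n ∸ u)) s ⟩
    ∣ s - s + (n ∸ u) ∣     ≡⟨ ∣m-m+n∣≡n s (n ∸ u) ⟩
    n ∸ u                   ∎
    where
    open ≡-Reasoning
    s = (j + u) % n
    s+n≡j+u : s + n ≡ j + u
    s+n≡j+u = begin
      (j + u) % n + n       ≡⟨ cong (_+ n) (m≤n⇒[n∸m]%m≡n%m n≤j+u) ⟨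
      (j + u ∸ n) % n + n   ≡⟨ cong (_+ n) (m<n⇒m%n≡m j+u∸n<n) ⟩
      j + u ∸ n + n         ≡⟨ m∸n+n≡m n≤j+u ⟩
      j + u                 ∎
      where
      j+u∸n<n : j + u ∸ n < n
      j+u∸n<n = +-cancelʳ-< _ _ n (subst (_< n + n) (sym (m∸n+n≡m n≤j+u)) (+-mono-<-≤ j<n u≤n))
    j≡s+[n∸u] : j ≡ s + (n ∸ u)
    j≡s+[n∸u] = +-cancelʳ-≡ u j (s + (n ∸ u)) (begin
      j + u             ≡⟨ s+n≡j+u ⟨
      s + n             ≡⟨ cong (s +_) (m∸n+n≡m u≤n) ⟨
      s + (n ∸ u + u)   ≡⟨ +-assoc s (n ∸ u) u ⟨
      s + (n ∸ u) + u   ∎)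

  ‖u‖≤∣j-[j+u]%n∣ : ∀ {j u} → j < n → u ≤ n → ‖ u ‖⟨ n ⟩ ≤ ∣ j - (j + u) % n ∣
  ‖u‖≤∣j-[j+u]%n∣ {j} {u} j<n u≤n with j + u <? n
  ... | yes j+u<n = subst (‖ u ‖⟨ n ⟩ ≤_) (sym (∣j-[j+u]%n∣≡u j+u<n)) (m⊓n≤m u (n ∸ u))
  ... | no  j+u≮n = subst (‖ u ‖⟨ n ⟩ ≤_) (sym (∣j-[j+u]%n∣≡n∸u j<n u≤n (≮⇒≥ j+u≮n))) (m⊓n≤n u (n ∸ u))

  [1+k]*j%n≡[j+k*j%n]%n : ∀ k j → (suc k * j) % n ≡ (j + (k * j) % n) % n
  [1+k]*j%n≡[j+k*j%n]%n k j = begin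
    (j + k * j) % n                           ≡⟨ cong (λ z → (j + z) % n) (m≡m%n+[m/n]*n (k * j) n) ⟩
    (j + ((k * j) % n + (k * j / n) * n)) % n ≡⟨ cong (_% n) (+-assoc j ((k * j) % n) _) ⟨
    (j + (k * j) % n + (k * j / n) * n) % n   ≡⟨ [m+kn]%n≡m%n (j + (k * j) % n) (k * j / n) n ⟩
    (j + (k * j) % n) % n                     ∎
    where open ≡-Reasoning

  ‖k*j%n‖≤∣j-[1+k]*j%n∣ : ∀ k {j} → j < n → ‖ (k * j) % n ‖⟨ n ⟩ ≤ ∣ j - (suc k * j) % n ∣
  ‖k*j%n‖≤∣j-[1+k]*j%n∣ k {j} j<n =
    subst (λ s → ‖ (k * j) % n ‖⟨ n ⟩ ≤ ∣ j - s ∣) (sym ([1+k]*j%n≡[j+k*j%n]%n k j))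
          (‖u‖≤∣j-[j+u]%n∣ j<n (m%n≤n (k * j) n))

  ∣j-2*j%n∣≡‖j‖ : ∀ {j} → j < n → ∣ j - (2 * j) % n ∣ ≡ ‖ j ‖⟨ n ⟩
  ∣j-2*j%n∣≡‖j‖ {j} j<n rewrite +-identityʳ j with j + j <? n
  ... | yes j+j<n = trans (∣j-[j+u]%n∣≡u j+j<n) (sym (x+x≤M⇒‖x‖≡x (<⇒≤ j+j<n)))
  ... | no  j+j≮n = trans (∣j-[j+u]%n∣≡n∸u j<n (<⇒≤ j<n) n≤j+j) (sym (M≤x+x⇒‖x‖≡M∸x n≤j+j))
    where
    n≤j+j : n ≤ j + j
    n≤j+j = ≮⇒≥ j+j≮n

  displacement-2≡∑‖j‖² : displacement 2 n ≡ ∑ n (λ j → ‖ j ‖⟨ n ⟩ ²)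
  displacement-2≡∑‖j‖² = ∑-cong n (λ j j<n → cong _² (∣j-2*j%n∣≡‖j‖ j<n))

6*∑i² : ∀ K → 6 * ∑ (suc K) _² ≡ K * (K + 1) * (2 * K + 1)
6*∑i² zero    = refl
6*∑i² (suc K) = begin
  6 * ∑ (suc (suc K)) _²                        ≡⟨ cong (6 *_) (∑-last (suc K) _²) ⟩
  6 * (∑ (suc K) _² + suc K ²)                  ≡⟨ *-distribˡ-+ 6 (∑ (suc K) _²) _ ⟩
  6 * ∑ (suc K) _² + 6 * suc K ²                ≡⟨ cong (_+ 6 * suc K ²) (6*∑i² K) ⟩
  K * (K + 1) * (2 * K + 1) + 6 * suc K ²       ≡⟨ step K ⟩
  suc K * (suc K + 1) * (2 * suc K + 1)         ∎
  where
  open ≡-Reasoning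
  step : ∀ K → K * (K + 1) * (2 * K + 1) + 6 * ((1 + K) * (1 + K)) ≡ (1 + K) * ((1 + K) + 1) * (2 * (1 + K) + 1)
  step = solve-∀

6*∑[K∸i]² : ∀ K → 6 * ∑ K (λ i → (K ∸ i) ²) ≡ K * (K + 1) * (2 * K + 1)
6*∑[K∸i]² zero    = refl
6*∑[K∸i]² (suc K) = begin
  6 * (suc K ² + ∑ K (λ i → (K ∸ i) ²))              ≡⟨ *-distribˡ-+ 6 (suc K ²) _ ⟩
  6 * suc K ² + 6 * ∑ K (λ i → (K ∸ i) ²)            ≡⟨ cong (6 * suc K ² +_) (6*∑[K∸i]² K) ⟩
  6 * suc K ² + K * (K + 1) * (2 * K + 1)            ≡⟨ step K ⟩
  suc K * (suc K + 1) * (2 * suc K + 1)              ∎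
  where
  open ≡-Reasoning
  step : ∀ K → 6 * ((1 + K) * (1 + K)) + K * (K + 1) * (2 * K + 1) ≡ (1 + K) * ((1 + K) + 1) * (2 * (1 + K) + 1)
  step = solve-∀

12*∑‖r‖²+N≡N³ : ∀ K → let N = suc (K + K) in 12 * ∑ N (λ r → ‖ r ‖⟨ N ⟩ ²) + N ≡ N * N * N
12*∑‖r‖²+N≡N³ K = begin
  12 * ∑ (suc K + K) f + N
    ≡⟨ cong (λ z → 12 * z + N) (∑-split (suc K) K f) ⟩
  12 * (∑ (suc K) f + ∑ K (λ i → f (suc K + i))) + N
    ≡⟨ cong₂ (λ x y → 12 * (x + y) + N) (∑-cong (suc K) lower) (∑-cong K upper) ⟩
  12 * (∑ (suc K) _² + ∑ K (λ i → (K ∸ i) ²)) + N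
    ≡⟨ regroup (∑ (suc K) _²) _ N ⟩
  2 * (6 * ∑ (suc K) _²) + 2 * (6 * ∑ K (λ i → (K ∸ i) ²)) + N
    ≡⟨ cong₂ (λ x y → 2 * x + 2 * y + N) (6*∑i² K) (6*∑[K∸i]² K) ⟩
  2 * (K * (K + 1) * (2 * K + 1)) + 2 * (K * (K + 1) * (2 * K + 1)) + N
    ≡⟨ cube K ⟩
  N * N * N
    ∎
  where
  open ≡-Reasoning
  N = suc (K + K)
  f : ℕ → ℕ
  f r = ‖ r ‖⟨ N ⟩ ²
  lower : ∀ r → r < suc K → f r ≡ r ²
  lower r (s≤s r≤K) = cong _² (x+x≤M⇒‖x‖≡x {r} (≤-trans (+-mono-≤ r≤K r≤K) (n≤1+n (K + K))))
  upper : ∀ i → i < K → f (suc K + i) ≡ (K ∸ i) ²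
  upper i _ = cong _² (trans (M≤x+x⇒‖x‖≡M∸x {suc K + i} (s≤s (+-mono-≤ (m≤m+n K i) (m≤n⇒m≤1+n (m≤m+n K i)))))
                             ([m+n]∸[m+o]≡n∸o K K i))
  regroup : ∀ p q N → 12 * (p + q) + N ≡ 2 * (6 * p) + 2 * (6 * q) + N
  regroup = solve-∀
  cube : ∀ K → 2 * (K * (K + 1) * (2 * K + 1)) + 2 * (K * (K + 1) * (2 * K + 1)) + suc (K + K)
             ≡ suc (K + K) * suc (K + K) * suc (K + K)
  cube = solve-∀

-- Comparison when m − 1 is coprime to n

m+m≤n⇒2≤n/m : ∀ {m n} .{{_ : NonZero m}} → m + m ≤ n → 2 ≤ n / m
m+m≤n⇒2≤n/m {m} {n} m+m≤n =
  subst (_≤ n / m) (m*n/n≡m 2 m) (/-monoˡ-≤ m (subst (_≤ n) (cong (m +_) (sym (+-identityʳ m))) m+m≤n))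

-- With m = 3 + a this says that n = (1 + r) + (2 + q) m stays below 2 (m − 1) (2 + q); the
-- excluded case is m = 3, n = 8.
remainder-bound : ∀ a q r → r ≤ 1 + a → ¬ (a ≡ 0 × q ≡ 0 × r ≡ 1) → suc r < (2 + q) * (1 + a)
remainder-bound (suc a) q r r≤1+a _ = begin-strict
  suc r                         ≤⟨ s≤s r≤1+a ⟩
  3 + a                         <⟨ s≤s (+-monoʳ-≤ 3 (m≤m+n a a)) ⟩
  4 + (a + a)                   ≡⟨ double a ⟩
  2 * (2 + a)                   ≤⟨ *-monoˡ-≤ (2 + a) (m≤m+n 2 q) ⟩
  (2 + q) * (2 + a)             ∎
  where
  open ≤-Reasoning
  double : ∀ a → 4 + (a + a) ≡ 2 * (2 + a)
  double = solve-∀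
remainder-bound zero q       zero                _      _   = s≤s (s≤s z≤n)
remainder-bound zero (suc q) (suc zero)          _      _   = s≤s (s≤s (s≤s z≤n))
remainder-bound zero zero    (suc zero)          _      bad = contradiction (refl , refl , refl) bad
remainder-bound zero q       (suc (suc r)) (s≤s ()) _

module _ (n : ℕ) .{{_ : NonZero n}} (n-odd : 2 ∤ n) where

  m+m≢n+2 : ∀ m → m + m ≢ n + 2
  m+m≢n+2 m m+m≡n+2 = n-odd (∣m+n∣m⇒∣n (subst (2 ∣_) (trans m+m≡n+2 (+-comm n 2)) (divides m (m+m≡m*2 m))) ∣-refl)
    where
    m+m≡m*2 : ∀ m → m + m ≡ m * 2
    m+m≡m*2 = solve-∀

  displacement-at-1 : ∀ m → m < n → n + 1 < m + m → n < 2 * ∣ 1 - (m * 1) % n ∣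
  displacement-at-1 m@(suc m′) m<n n+1<m+m = begin-strict
    n                      <⟨ +-cancelʳ-< 2 n (2 * m′) n+2<2m′+2 ⟩
    2 * m′                 ≡⟨ cong ((2 *_) ∘ ∣ 1 -_∣) (trans (cong (_% n) (*-identityʳ m)) (m<n⇒m%n≡m m<n)) ⟨
    2 * ∣ 1 - (m * 1) % n ∣ ∎
    where
    open ≤-Reasoning
    n+2<m+m : n + 2 < m + m
    n+2<m+m = ≤∧≢⇒< (subst (_≤ m + m) (sym (+-suc n 1)) n+1<m+m) (λ eq → m+m≢n+2 m (sym eq))
    n+2<2m′+2 : n + 2 < 2 * m′ + 2
    n+2<2m′+2 = subst (n + 2 <_) (shift m′) n+2<m+m
      where
      shift : ∀ m′ → suc m′ + suc m′ ≡ 2 * m′ + 2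
      shift = solve-∀

  displacement-at-quotient : ∀ a q r → n ≡ suc r + (2 + q) * (3 + a) → suc r < 3 + a →
                             2 + q < n × n < 2 * ∣ 2 + q - ((3 + a) * (2 + q)) % n ∣
  displacement-at-quotient a q r n≡ r<m = <-trans q<mq mq<n , (begin-strict
    n                                     ≡⟨ n≡ ⟩
    suc r + (2 + q) * (3 + a)             <⟨ +-monoˡ-< _ (remainder-bound a q r r≤1+a not-8) ⟩
    (2 + q) * (1 + a) + (2 + q) * (3 + a) ≡⟨ collect a q ⟩
    2 * ((2 + a) * (2 + q))               ≡⟨ cong (2 *_) (∣m-m+n∣≡n (2 + q) _) ⟨
    2 * ∣ 2 + q - (3 + a) * (2 + q) ∣     ≡⟨ cong (λ s → 2 * ∣ 2 + q - s ∣) (m<n⇒m%n≡m mq<n) ⟨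
    2 * ∣ 2 + q - ((3 + a) * (2 + q)) % n ∣ ∎)
    where
    open ≤-Reasoning
    r≤1+a : r ≤ 1 + a
    r≤1+a = ≤-pred (≤-pred r<m)
    not-8 : ¬ (a ≡ 0 × q ≡ 0 × r ≡ 1)
    not-8 (refl , refl , refl) = n-odd (divides 4 n≡)
    q<mq : 2 + q < (3 + a) * (2 + q)
    q<mq = m<m+n (2 + q) z<s
    mq<n : (3 + a) * (2 + q) < n
    mq<n = subst₂ _<_ (*-comm (2 + q) (3 + a)) (sym n≡) (s≤s (m≤n+m _ r))
    collect : ∀ a q → (2 + q) * (1 + a) + (2 + q) * (3 + a) ≡ 2 * ((2 + a) * (2 + q))
    collect = solve-∀

  displacement-at-n/m : ∀ m .{{_ : NonZero m}} → 3 ≤ m → m + m ≤ n → m ∤ n →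
                        ∃[ q ] q < n × n < 2 * ∣ q - (m * q) % n ∣
  displacement-at-n/m m@(suc (suc (suc a))) (s≤s (s≤s (s≤s _))) m+m≤n m∤n
    with n % m in r≡ | n / m in q≡ | m+m≤n⇒2≤n/m m+m≤n | m%n<n n m
  ... | zero  | _           | _             | _   = contradiction (m%n≡0⇒n∣m n m r≡) m∤n
  ... | suc r | suc zero    | s≤s ()        | _
  ... | suc r | suc (suc q) | _             | r<m =
    2 + q , displacement-at-quotient a q r n≡ r<m
    where
    n≡ : n ≡ suc r + (2 + q) * m
    n≡ = trans (m≡m%n+[m/n]*n n m) (cong₂ (λ x y → x + y * m) r≡ q≡)

  displacement-witness : ∀ m → 3 ≤ m → m < n → gcd m n ≡ 1 → m + m ≢ n + 1 →
                         ∃[ w ] w < n × n < 2 * ∣ w - (m * w) % n ∣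
  displacement-witness m@(suc _) 3≤m m<n gcd≡1 m+m≢n+1 with n + 1 <? m + m
  ... | yes n+1<m+m = 1 , <-trans (≤-trans (s≤s (s≤s z≤n)) 3≤m) m<n , displacement-at-1 m m<n n+1<m+m
  ... | no  n+1≮m+m = displacement-at-n/m m 3≤m m+m≤n m∤n
    where
    m+m≤n : m + m ≤ n
    m+m≤n = s≤s⁻¹ (subst (m + m <_) (+-comm n 1) (≤∧≢⇒< (≮⇒≥ n+1≮m+m) m+m≢n+1))
    m∤n : m ∤ n
    m∤n m∣n = <⇒≢ (≤-trans (s≤s (s≤s z≤n)) 3≤m)
                  (sym (∣1⇒≡1 (subst (m ∣_) gcd≡1 (gcd-greatest ∣-refl m∣n))))

  displacement-2<displacement-coprime : ∀ k → 3 ≤ suc k → suc k < n → gcd (suc k) n ≡ 1 →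
                                         suc k + suc k ≢ n + 1 → gcd k n ≡ 1 →
                                         displacement 2 n < displacement (suc k) n
  displacement-2<displacement-coprime k 3≤m m<n gcd[m,n]≡1 m+m≢n+1 gcd[k,n]≡1
    with displacement-witness (suc k) 3≤m m<n gcd[m,n]≡1 m+m≢n+1
  ... | w , w<n , n<2d = begin-strict
    displacement 2 n                          ≡⟨ displacement-2≡∑‖j‖² n ⟩
    ∑ n (λ j → ‖ j ‖⟨ n ⟩ ²)                  ≡⟨ ∑-*%-permute n k (λ x → ‖ x ‖⟨ n ⟩ ²) gcd[k,n]≡1 ⟨
    ∑ n (λ j → ‖ (k * j) % n ‖⟨ n ⟩ ²)        <⟨ m<m+n _ z<s ⟩
    ∑ n (λ j → ‖ (k * j) % n ‖⟨ n ⟩ ²) + 1    ≤⟨ ∑-mono-≤-gain n w (λ j j<n → ²-mono-≤ (lower j<n)) w<n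
                                                   gain-at-w ⟩
    displacement (suc k) n                    ∎
    where
    open ≤-Reasoning
    lower : ∀ {j} → j < n → ‖ (k * j) % n ‖⟨ n ⟩ ≤ ∣ j - (suc k * j) % n ∣
    lower = ‖k*j%n‖≤∣j-[1+k]*j%n∣ n k
    u = (k * w) % n
    d = ∣ w - (suc k * w) % n ∣
    gain-at-w : ‖ u ‖⟨ n ⟩ ² + 1 ≤ d ²
    gain-at-w = subst (_≤ d ²) (+-comm 1 (‖ u ‖⟨ n ⟩ ²))
                      (2*‖u‖≤n<2*d⇒‖u‖²<d² {u} {n} {d} (m%n≤n (k * w) n) n<2d)

-- Comparison when m − 1 and n share a factor

-- Here m − 1 = g v with g = gcd (m − 1) n, and the index j = i N + r sits in row i, column r.
module NonCoprime (G K v : ℕ) (1≤G : 1 ≤ G) (1≤K : 1 ≤ K) (gcd[v,N]≡1 : gcd v (suc (K + K)) ≡ 1) where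
  g N n : ℕ
  g = suc (G + G)
  N = suc (K + K)
  n = g * N

  term : ℕ → ℕ → ℕ
  term i r = ∣ i * N + r - (suc (g * v) * (i * N + r)) % n ∣ ²

  C : ℕ
  C = ∑ N (λ r → ‖ r ‖⟨ N ⟩ ²)

  i*N+r<n : ∀ {i r} → i < g → r < N → i * N + r < n
  i*N+r<n {i} {r} i<g r<N = begin-strict
    i * N + r <⟨ +-monoʳ-< (i * N) r<N ⟩
    i * N + N ≡⟨ +-comm (i * N) N ⟩
    suc i * N ≤⟨ *-monoˡ-≤ N i<g ⟩
    n         ∎
    where open ≤-Reasoning

  g*v*[i*N+r]%n : ∀ i r → (g * v * (i * N + r)) % n ≡ g * ((v * r) % N)
  g*v*[i*N+r]%n i r = begin
    (g * v * (i * N + r)) % n       ≡⟨ cong (_% n) (expand g v i N r) ⟩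
    (v * r * g + (v * i) * n) % n   ≡⟨ [m+kn]%n≡m%n (v * r * g) (v * i) n ⟩
    (v * r * g) % (g * N)           ≡⟨ %-congʳ {o = v * r * g} (*-comm g N) ⟩
    (v * r * g) % (N * g)           ≡⟨ m%n*o≡m*o%[n*o] (v * r) N g ⟨
    (v * r) % N * g                 ≡⟨ *-comm _ g ⟩
    g * ((v * r) % N)               ∎
    where
    open ≡-Reasoning
    expand : ∀ g v i N r → g * v * (i * N + r) ≡ v * r * g + (v * i) * (g * N)
    expand = solve-∀

  term-lower : ∀ {i r} → i < g → r < N → g ² * ‖ (v * r) % N ‖⟨ N ⟩ ² ≤ term i r
  term-lower {i} {r} i<g r<N = begin
    g ² * ‖ (v * r) % N ‖⟨ N ⟩ ²           ≡⟨ *-² g (‖ (v * r) % N ‖⟨ N ⟩) ⟨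
    (g * ‖ (v * r) % N ‖⟨ N ⟩) ²           ≡⟨ cong _² (‖g*x‖⟨g*M⟩≡g*‖x‖ g ((v * r) % N) N) ⟨
    ‖ g * ((v * r) % N) ‖⟨ n ⟩ ²           ≡⟨ cong (λ x → ‖ x ‖⟨ n ⟩ ²) (g*v*[i*N+r]%n i r) ⟨
    ‖ (g * v * (i * N + r)) % n ‖⟨ n ⟩ ²   ≤⟨ ²-mono-≤ (‖k*j%n‖≤∣j-[1+k]*j%n∣ n (g * v) (i*N+r<n i<g r<N)) ⟩
    term i r                               ∎
    where open ≤-Reasoning

  v⁻¹ : ℕ
  v⁻¹ = proj₁ (%-inverse v N gcd[v,N]≡1)

  r★ : ℕ
  r★ = (v⁻¹ * K) % N

  r★<N : r★ < N
  r★<N = m%n<n (v⁻¹ * K) N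

  v*r★%N≡K : (v * r★) % N ≡ K
  v*r★%N≡K = *-%-inverse {v} K N (proj₂ (%-inverse v N gcd[v,N]≡1)) (s≤s (m≤m+n K K))

  -- In the rows t ≤ i < g the column r★ wraps around n (g*[K+1]≤i*N), and there are q ≥ g/12 of them.
  q t : ℕ
  q = g / 3
  t = g ∸ q

  t+q≡g : t + q ≡ g
  t+q≡g = m∸n+n≡m (m/n≤m g 3)

  3*q≤g : 3 * q ≤ g
  3*q≤g = subst (_≤ g) (*-comm q 3) (m/n*n≤m g 3)

  g≤12*q : g ≤ 12 * q
  g≤12*q = begin
    g                 ≡⟨ m≡m%n+[m/n]*n g 3 ⟩
    g % 3 + q * 3     ≤⟨ +-mono-≤ (≤-pred (m%n<n g 3)) (≤-reflexive (*-comm q 3)) ⟩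
    2 + 3 * q         ≤⟨ +-monoˡ-≤ (3 * q) (≤-trans (s≤s (s≤s z≤n)) (*-monoʳ-≤ 9 1≤q)) ⟩
    9 * q + 3 * q     ≡⟨ *-distribʳ-+ q 9 3 ⟨
    12 * q            ∎
    where
    open ≤-Reasoning
    1≤q : 1 ≤ q
    1≤q = /-monoˡ-≤ 3 (s≤s (+-mono-≤ 1≤G 1≤G))

  g*[K+1]≤i*N : ∀ {i} → t ≤ i → g * (K + 1) ≤ i * N
  g*[K+1]≤i*N {i} t≤i = *-cancelˡ-≤ 3 (begin
    3 * (g * (K + 1))                ≤⟨ m≤m+n _ _ ⟩
    3 * (g * (K + 1)) + g * (K ∸ 1)  ≡⟨ thirds g K 1≤K ⟩
    2 * g * N                        ≤⟨ *-monoˡ-≤ N 2*g≤3*i ⟩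
    3 * i * N                        ≡⟨ *-assoc 3 i N ⟩
    3 * (i * N)                      ∎)
    where
    open ≤-Reasoning
    2*g≤3*i : 2 * g ≤ 3 * i
    2*g≤3*i = +-cancelʳ-≤ g (2 * g) (3 * i) (begin
      2 * g + g         ≡⟨ triple g ⟩
      3 * g             ≡⟨ cong (3 *_) t+q≡g ⟨
      3 * (t + q)       ≡⟨ *-distribˡ-+ 3 t q ⟩
      3 * t + 3 * q     ≤⟨ +-mono-≤ (*-monoʳ-≤ 3 t≤i) 3*q≤g ⟩
      3 * i + g         ∎)
      where
      triple : ∀ g → 2 * g + g ≡ 3 * g
      triple = solve-∀
    thirds : ∀ g K → 1 ≤ K → 3 * (g * (K + 1)) + g * (K ∸ 1) ≡ 2 * g * suc (K + K)
    thirds g (suc K) _ = expand g K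
      where
      expand : ∀ g K → 3 * (g * (suc K + 1)) + g * K ≡ 2 * g * suc (suc K + suc K)
      expand = solve-∀

  term-gain : ∀ {i} → i < g → t ≤ i → g ² * ‖ (v * r★) % N ‖⟨ N ⟩ ² + n * g ≤ term i r★
  term-gain {i} i<g t≤i = ≤-reflexive (begin
    g ² * ‖ (v * r★) % N ‖⟨ N ⟩ ² + n * g  ≡⟨ cong (λ x → g ² * ‖ x ‖⟨ N ⟩ ² + n * g) v*r★%N≡K ⟩
    g ² * ‖ K ‖⟨ N ⟩ ² + n * g             ≡⟨ cong (λ x → g ² * x ² + n * g) (x+x≤M⇒‖x‖≡x {K} (n≤1+n (K + K))) ⟩
    g ² * K ² + n * g                      ≡⟨ complete-square g K ⟩
    (g * (K + 1)) ²                        ≡⟨ cong _² (m+n∸n≡m (g * (K + 1)) (g * K)) ⟨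
    (g * (K + 1) + g * K ∸ g * K) ²        ≡⟨ cong (λ x → (x ∸ g * K) ²) n≡ ⟨
    (n ∸ g * K) ²                          ≡⟨ cong _² (∣j-[j+u]%n∣≡n∸u n (i*N+r<n i<g r★<N) u≤n wraps) ⟨
    ∣ j - (j + g * K) % n ∣ ²              ≡⟨ cong (λ x → ∣ j - (j + x) % n ∣ ²) u≡g*K ⟨
    ∣ j - (j + u) % n ∣ ²                  ≡⟨ cong (λ x → ∣ j - x ∣ ²) ([1+k]*j%n≡[j+k*j%n]%n n (g * v) j) ⟨
    term i r★                              ∎)
    where
    open ≡-Reasoning
    j u : ℕ
    j = i * N + r★
    u = (g * v * j) % n
    u≡g*K : u ≡ g * K
    u≡g*K = trans (g*v*[i*N+r]%n i r★) (cong (g *_) v*r★%N≡K)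
    n≡ : n ≡ g * (K + 1) + g * K
    n≡ = split g K
      where
      split : ∀ g K → g * suc (K + K) ≡ g * (K + 1) + g * K
      split = solve-∀
    u≤n : g * K ≤ n
    u≤n = subst (g * K ≤_) (sym n≡) (m≤n+m (g * K) (g * (K + 1)))
    wraps : n ≤ j + g * K
    wraps = subst (_≤ j + g * K) (sym n≡) (+-monoˡ-≤ (g * K) (≤-trans (g*[K+1]≤i*N t≤i) (m≤m+n (i * N) r★)))
    complete-square : ∀ g K → (g * g) * (K * K) + (g * suc (K + K)) * g ≡ (g * (K + 1)) * (g * (K + 1))
    complete-square = solve-∀

  ∑-g²‖v*r%N‖² : ∑ N (λ r → g ² * ‖ (v * r) % N ‖⟨ N ⟩ ²) ≡ g ² * C
  ∑-g²‖v*r%N‖² = trans (∑-*ˡ N (g ²) (λ r → ‖ (v * r) % N ‖⟨ N ⟩ ²))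
                       (cong (g ² *_) (∑-*%-permute N v (λ x → ‖ x ‖⟨ N ⟩ ²) gcd[v,N]≡1))

  row-lower : ∀ {i} → i < g → g ² * C ≤ ∑ N (term i)
  row-lower {i} i<g = subst (_≤ ∑ N (term i)) ∑-g²‖v*r%N‖² (∑-mono-≤ N (λ r r<N → term-lower i<g r<N))

  row-gain : ∀ {i} → i < g → t ≤ i → g ² * C + n * g ≤ ∑ N (term i)
  row-gain {i} i<g t≤i = subst (λ x → x + n * g ≤ ∑ N (term i)) ∑-g²‖v*r%N‖²
    (∑-mono-≤-gain N r★ (λ r r<N → term-lower i<g r<N) r★<N (term-gain i<g t≤i))

  displacement-lower : g * (g ² * C) + q * (n * g) ≤ displacement (suc (g * v)) n
  displacement-lower = begin
    g * X + q * (n * g)                                       ≡⟨ cong (λ k → k * X + q * (n * g)) t+q≡g ⟨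
    (t + q) * X + q * (n * g)                                 ≡⟨ regroup t q X (n * g) ⟩
    t * X + q * (X + n * g)                                   ≡⟨ cong₂ _+_ (∑-const t X) (∑-const q (X + n * g)) ⟨
    ∑ t (λ _ → X) + ∑ q (λ _ → X + n * g)                     ≤⟨ +-mono-≤
                                                                   (∑-mono-≤ t (λ i i<t → row-lower (<-≤-trans i<t (m∸n≤m g q))))
                                                                   (∑-mono-≤ q (λ i i<q → row-gain (t+i<g i<q) (m≤m+n t i))) ⟩
    ∑ t (λ i → ∑ N (term i)) + ∑ q (λ i → ∑ N (term (t + i))) ≡⟨ ∑-split t q (λ i → ∑ N (term i)) ⟨
    ∑ (t + q) (λ i → ∑ N (term i))                            ≡⟨ cong (λ k → ∑ k (λ i → ∑ N (term i))) t+q≡g ⟩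
    ∑ g (λ i → ∑ N (term i))                                  ≡⟨ ∑-rows g N (λ j → ∣ j - (suc (g * v) * j) % n ∣ ²) ⟨
    displacement (suc (g * v)) n                              ∎
    where
    open ≤-Reasoning
    X = g ² * C
    t+i<g : ∀ {i} → i < q → t + i < g
    t+i<g {i} i<q = subst (t + i <_) t+q≡g (+-monoʳ-< t i<q)
    regroup : ∀ t q X Y → (t + q) * X + q * Y ≡ t * X + q * (X + Y)
    regroup = solve-∀

  12*displacement-2+n≡n³ : 12 * displacement 2 n + n ≡ n * n * n
  12*displacement-2+n≡n³ = trans (cong (λ x → 12 * x + n) (displacement-2≡∑‖j‖² n))
    (subst (λ M → 12 * ∑ M (λ r → ‖ r ‖⟨ M ⟩ ²) + M ≡ M * M * M) (odd-* G K) (12*∑‖r‖²+N≡N³ (G + K + 2 * G * K)))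
    where
    odd-* : ∀ G K → suc (G + K + 2 * G * K + (G + K + 2 * G * K)) ≡ suc (G + G) * suc (K + K)
    odd-* = solve-∀

  displacement-2<displacement : displacement 2 n < displacement (suc (g * v)) n
  displacement-2<displacement = *-cancelˡ-< 12 _ _ (begin-strict
    12 * displacement 2 n                       <⟨ m<m+n _ z<s ⟩
    12 * displacement 2 n + n                   ≡⟨ 12*displacement-2+n≡n³ ⟩
    n * n * n                                   ≡⟨ cube-* g N ⟩
    (g * g * g) * (N * N * N)                   ≡⟨ cong ((g * g * g) *_) (12*∑‖r‖²+N≡N³ K) ⟨
    (g * g * g) * (12 * C + N)                  ≡⟨ expand g N C ⟩
    12 * (g * (g ² * C)) + g ² * n              ≤⟨ +-monoʳ-≤ _ g²*n≤12*[q*[n*g]] ⟩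
    12 * (g * (g ² * C)) + 12 * (q * (n * g))   ≡⟨ *-distribˡ-+ 12 (g * (g ² * C)) (q * (n * g)) ⟨
    12 * (g * (g ² * C) + q * (n * g))          ≤⟨ *-monoʳ-≤ 12 displacement-lower ⟩
    12 * displacement (suc (g * v)) n           ∎)
    where
    open ≤-Reasoning
    g²*n≤12*[q*[n*g]] : g ² * n ≤ 12 * (q * (n * g))
    g²*n≤12*[q*[n*g]] = begin
      (g * g) * n          ≤⟨ *-monoˡ-≤ n (*-monoʳ-≤ g g≤12*q) ⟩
      (g * (12 * q)) * n   ≡⟨ rearrange g q n ⟩
      12 * (q * (n * g))   ∎
      where
      rearrange : ∀ g q n → (g * (12 * q)) * n ≡ 12 * (q * (n * g))
      rearrange = solve-∀
    cube-* : ∀ g N → (g * N) * (g * N) * (g * N) ≡ (g * g * g) * (N * N * N)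
    cube-* = solve-∀
    expand : ∀ g N C → (g * g * g) * (12 * C + N) ≡ 12 * (g * ((g * g) * C)) + (g * g) * (g * N)
    expand = solve-∀

odd-divisor : ∀ {n d} → 2 ∤ n → d ∣ n → ∃[ D ] d ≡ suc (D + D)
odd-divisor {d = d} n-odd d∣n with d % 2 in d%2≡ | m%n<n d 2
... | zero        | _              = contradiction (∣-trans (m%n≡0⇒n∣m d 2 d%2≡) d∣n) n-odd
... | suc zero    | _              = d / 2 , (begin
  d                 ≡⟨ m≡m%n+[m/n]*n d 2 ⟩
  d % 2 + d / 2 * 2 ≡⟨ cong (_+ d / 2 * 2) d%2≡ ⟩
  1 + d / 2 * 2     ≡⟨ cong suc (x*2≡x+x (d / 2)) ⟩
  1 + (d / 2 + d / 2) ∎)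
  where
  open ≡-Reasoning
  x*2≡x+x : ∀ x → x * 2 ≡ x + x
  x*2≡x+x = solve-∀
... | suc (suc _) | s≤s (s≤s ())

data OddGcdSplit : ℕ → ℕ → Set where
  oddGcdSplit : ∀ G K v → 1 ≤ G → 1 ≤ K → gcd v (suc (K + K)) ≡ 1 →
                OddGcdSplit (suc (G + G) * v) (suc (G + G) * suc (K + K))

oddGcdSplit-of : ∀ {k n} → 2 ∤ n → 0 < k → k < n → gcd k n ≢ 1 → OddGcdSplit k n
oddGcdSplit-of {k} {n} n-odd 0<k k<n gcd≢1
  with gcd[m,n]∣m k n | gcd[m,n]∣n k n
... | divides v k≡v*g | divides N n≡N*g
  with odd-divisor n-odd (gcd[m,n]∣n k n) | odd-divisor n-odd (divides (gcd k n) (trans n≡N*g (*-comm N _)))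
... | zero , g≡1     | _             = contradiction g≡1 gcd≢1
... | suc G , _      | zero , N≡1    = contradiction (<-≤-trans k<n n≤k) (<-irrefl refl)
  where
  n≤k : n ≤ k
  n≤k = subst (_≤ k) (sym (trans n≡N*g (trans (cong (_* gcd k n) N≡1) (*-identityˡ _))))
              (∣⇒≤ {{>-nonZero 0<k}} (gcd[m,n]∣m k n))
... | suc G , g≡     | suc K , N≡    =
  subst₂ OddGcdSplit (sym k≡g*v) (sym n≡g*N) (oddGcdSplit (suc G) (suc K) v (s≤s z≤n) (s≤s z≤n) coprime)
  where
  g = suc (suc G + suc G)
  k≡g*v : k ≡ g * v
  k≡g*v = trans k≡v*g (trans (*-comm v _) (cong (_* v) g≡))
  n≡g*N : n ≡ g * suc (suc K + suc K)
  n≡g*N = trans n≡N*g (trans (*-comm N _) (cong₂ _*_ g≡ N≡))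
  coprime : gcd v (suc (suc K + suc K)) ≡ 1
  coprime = *-cancelˡ-≡ _ 1 g (begin
    g * gcd v (suc (suc K + suc K))       ≡⟨ c*gcd[m,n]≡gcd[cm,cn] g v _ ⟩
    gcd (g * v) (g * suc (suc K + suc K)) ≡⟨ cong₂ gcd k≡g*v n≡g*N ⟨
    gcd k n                               ≡⟨ g≡ ⟩
    g                                     ≡⟨ *-identityʳ g ⟨
    g * 1                                 ∎)
    where open ≡-Reasoning

displacement-2<displacement : ∀ n m .{{_ : NonZero n}} → 2 ∤ n → 3 ≤ m → m < n → gcd m n ≡ 1 →
                              m + m ≢ n + 1 → displacement 2 n < displacement m n
displacement-2<displacement n (suc k) n-odd 3≤m m<n gcd[m,n]≡1 m+m≢n+1 with gcd k n ≟ 1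
... | yes gcd[k,n]≡1 =
  displacement-2<displacement-coprime n n-odd k 3≤m m<n gcd[m,n]≡1 m+m≢n+1 gcd[k,n]≡1
... | no  gcd[k,n]≢1 with oddGcdSplit-of n-odd 0<k (<-trans (n<1+n k) m<n) gcd[k,n]≢1
  where
  0<k : 0 < k
  0<k = ≤-pred (≤-trans (s≤s (s≤s z≤n)) 3≤m)
...   | oddGcdSplit G K v 1≤G 1≤K gcd[v,N]≡1 =
  NonCoprime.displacement-2<displacement G K v 1≤G 1≤K gcd[v,N]≡1

-- The Dedekind sum in terms of the displacement

fromℕ : ℕ → ℚ
fromℕ a = ℤ.+ a ℚ./ 1

toℚᵘ-fromℕ : ∀ a → toℚᵘ (fromℕ a) ℚᵘ.≃ mkℚᵘ (ℤ.+ a) 0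
toℚᵘ-fromℕ a = ℚP.toℚᵘ-fromℚᵘ (mkℚᵘ (ℤ.+ a) 0)

fromℕ-+ : ∀ a b → fromℕ (a + b) ≡ fromℕ a ℚ.+ fromℕ b
fromℕ-+ a b = ℚP.toℚᵘ-injective (begin
  toℚᵘ (fromℕ (a + b))                ≈⟨ toℚᵘ-fromℕ (a + b) ⟩
  mkℚᵘ (ℤ.+ (a + b)) 0                ≈⟨ *≡* (trans (cong (ℤ._* ℤ.+ 1) (ℤP.pos-+ a b)) (cross (ℤ.+ a) (ℤ.+ b))) ⟩
  mkℚᵘ (ℤ.+ a) 0 ℚᵘ.+ mkℚᵘ (ℤ.+ b) 0  ≈⟨ ℚᵘP.+-cong (toℚᵘ-fromℕ a) (toℚᵘ-fromℕ b) ⟨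
  toℚᵘ (fromℕ a) ℚᵘ.+ toℚᵘ (fromℕ b)  ≈⟨ ℚP.toℚᵘ-homo-+ (fromℕ a) (fromℕ b) ⟨
  toℚᵘ (fromℕ a ℚ.+ fromℕ b)          ∎)
  where
  open ℚᵘP.≃-Reasoning
  cross : ∀ a b → (a ℤ.+ b) ℤ.* ℤ.+ 1 ≡ (a ℤ.* ℤ.+ 1 ℤ.+ b ℤ.* ℤ.+ 1) ℤ.* ℤ.+ 1
  cross = ℤ-Solver.solve-∀

fromℕ-* : ∀ a b → fromℕ (a * b) ≡ fromℕ a ℚ.* fromℕ b
fromℕ-* a b = ℚP.toℚᵘ-injective (begin
  toℚᵘ (fromℕ (a * b))                ≈⟨ toℚᵘ-fromℕ (a * b) ⟩
  mkℚᵘ (ℤ.+ (a * b)) 0                ≈⟨ *≡* (cong (ℤ._* ℤ.+ 1) (ℤP.pos-* a b)) ⟩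
  mkℚᵘ (ℤ.+ a) 0 ℚᵘ.* mkℚᵘ (ℤ.+ b) 0  ≈⟨ ℚᵘP.*-cong (toℚᵘ-fromℕ a) (toℚᵘ-fromℕ b) ⟨
  toℚᵘ (fromℕ a) ℚᵘ.* toℚᵘ (fromℕ b)  ≈⟨ ℚP.toℚᵘ-homo-* (fromℕ a) (fromℕ b) ⟨
  toℚᵘ (fromℕ a ℚ.* fromℕ b)          ∎)
  where open ℚᵘP.≃-Reasoning

fromℕ-< : ∀ {a b} → a < b → fromℕ a <ℚ fromℕ b
fromℕ-< {a} {b} a<b = ℚP.toℚᵘ-cancel-<
  (ℚᵘP.<-respˡ-≃ (ℚᵘP.≃-sym (toℚᵘ-fromℕ a)) (ℚᵘP.<-respʳ-≃ (ℚᵘP.≃-sym (toℚᵘ-fromℕ b))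
    (*<* (subst₂ ℤ._<_ (sym (ℤP.*-identityʳ (ℤ.+ a))) (sym (ℤP.*-identityʳ (ℤ.+ b))) (ℤ.+<+ a<b)))))

/-fromℕ : ∀ a n .{{_ : NonZero n}} → ℤ.+ a ℚ./ n ≡ fromℕ a ℚ.* (ℤ.+ 1 ℚ./ n)
/-fromℕ a n@(suc n₀) = ℚP.toℚᵘ-injective (begin
  toℚᵘ (ℤ.+ a ℚ./ n)
    ≈⟨ ℚP.toℚᵘ-fromℚᵘ (mkℚᵘ (ℤ.+ a) n₀) ⟩
  mkℚᵘ (ℤ.+ a) n₀
    ≈⟨ *≡* (trans (cong (λ k → ℤ.+ a ℤ.* ℤ.+ suc k) (+-identityʳ n₀)) (cross (ℤ.+ a) (ℤ.+ n))) ⟩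
  mkℚᵘ (ℤ.+ a) 0 ℚᵘ.* mkℚᵘ (ℤ.+ 1) n₀
    ≈⟨ ℚᵘP.*-cong (toℚᵘ-fromℕ a) (ℚP.toℚᵘ-fromℚᵘ (mkℚᵘ (ℤ.+ 1) n₀)) ⟨
  toℚᵘ (fromℕ a) ℚᵘ.* toℚᵘ (ℤ.+ 1 ℚ./ n)
    ≈⟨ ℚP.toℚᵘ-homo-* (fromℕ a) (ℤ.+ 1 ℚ./ n) ⟨
  toℚᵘ (fromℕ a ℚ.* (ℤ.+ 1 ℚ./ n))
    ∎)
  where
  open ℚᵘP.≃-Reasoning
  cross : ∀ a d → a ℤ.* d ≡ (a ℤ.* ℤ.+ 1) ℤ.* d
  cross = ℤ-Solver.solve-∀

module ℚ∑ = RangeSum ℚP.+-0-isCommutativeMonoid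

fromℕ-∑ : ∀ n (f : ℕ → ℕ) c → ℚ∑.∑ n (λ i → fromℕ (f i) ℚ.* c) ≡ fromℕ (∑ n f) ℚ.* c
fromℕ-∑ zero    f c = sym (ℚP.*-zeroˡ c)
fromℕ-∑ (suc n) f c = begin
  fromℕ (f 0) ℚ.* c ℚ.+ ℚ∑.∑ n (λ i → fromℕ (f (suc i)) ℚ.* c)
    ≡⟨ cong (fromℕ (f 0) ℚ.* c ℚ.+_) (fromℕ-∑ n (f ∘ suc) c) ⟩
  fromℕ (f 0) ℚ.* c ℚ.+ fromℕ (∑ n (f ∘ suc)) ℚ.* c
    ≡⟨ ℚP.*-distribʳ-+ c (fromℕ (f 0)) _ ⟨
  (fromℕ (f 0) ℚ.+ fromℕ (∑ n (f ∘ suc))) ℚ.* c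
    ≡⟨ cong (ℚ._* c) (fromℕ-+ (f 0) _) ⟨
  fromℕ (∑ (suc n) f) ℚ.* c
    ∎
  where open ≡-Reasoning

a≤b⇒fromℕ-∣-∣² : ∀ {a b} → a ≤ b → (fromℕ a ℚ.- fromℕ b) ℚ.* (fromℕ a ℚ.- fromℕ b) ≡ fromℕ (∣ a - b ∣ ²)
a≤b⇒fromℕ-∣-∣² {a} {b} a≤b = begin
  (A ℚ.- fromℕ b) ℚ.* (A ℚ.- fromℕ b)       ≡⟨ cong (λ x → (A ℚ.- x) ℚ.* (A ℚ.- x)) b≡a+d ⟩
  (A ℚ.- (A ℚ.+ D)) ℚ.* (A ℚ.- (A ℚ.+ D))   ≡⟨ cancel A D ⟩
  D ℚ.* D                                   ≡⟨ fromℕ-* d d ⟨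
  fromℕ (d ²)                               ≡⟨ cong (fromℕ ∘ _²) (m≤n⇒∣m-n∣≡n∸m a≤b) ⟨
  fromℕ (∣ a - b ∣ ²)                       ∎
  where
  open ≡-Reasoning
  d = b ∸ a
  A = fromℕ a
  D = fromℕ d
  b≡a+d : fromℕ b ≡ A ℚ.+ D
  b≡a+d = trans (cong fromℕ (sym (m+[n∸m]≡n a≤b))) (fromℕ-+ a d)
  cancel : ∀ A D → (A ℚ.- (A ℚ.+ D)) ℚ.* (A ℚ.- (A ℚ.+ D)) ≡ D ℚ.* D
  cancel = solve 2 (λ A D → (A :- (A :+ D)) :* (A :- (A :+ D)) := D :* D) refl
    where open +-*-Solver

fromℕ-∣-∣² : ∀ a b → (fromℕ a ℚ.- fromℕ b) ℚ.* (fromℕ a ℚ.- fromℕ b) ≡ fromℕ (∣ a - b ∣ ²)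
fromℕ-∣-∣² a b with ≤-total a b
... | inj₁ a≤b = a≤b⇒fromℕ-∣-∣² a≤b
... | inj₂ b≤a = trans (swap (fromℕ a) (fromℕ b)) (trans (a≤b⇒fromℕ-∣-∣² b≤a) (cong (fromℕ ∘ _²) (∣-∣-comm b a)))
  where
  swap : ∀ A B → (A ℚ.- B) ℚ.* (A ℚ.- B) ≡ (B ℚ.- A) ℚ.* (B ℚ.- A)
  swap = solve 2 (λ A B → (A :- B) :* (A :- B) := (B :- A) :* (B :- A)) refl
    where open +-*-Solver

module _ (n : ℕ) .{{_ : NonZero n}} where

  w ½w² : ℚ
  w   = ℤ.+ 1 ℚ./ n
  ½w² = ½ ℚ.* (w ℚ.* w)

  saw-zero : ∀ {a} → a % n ≡ 0 → saw a n ≡ 0ℚ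
  saw-zero {a} a%n≡0 with a % n | a%n≡0
  ... | _ | refl = refl

  saw-suc : ∀ {a r} → a % n ≡ suc r → saw a n ≡ fromℕ (suc r) ℚ.* w ℚ.- ½
  saw-suc {a} {r} a%n≡1+r with a % n | a%n≡1+r
  ... | _ | refl = cong (ℚ._- ½) (/-fromℕ (suc r) n)

  saw-% : ∀ a → saw a n ≡ saw (a % n) n
  saw-% a = by-residue (a % n) refl
    where
    by-residue : ∀ r → a % n ≡ r → saw a n ≡ saw (a % n) n
    by-residue zero    a%n≡0   = trans (saw-zero a%n≡0) (sym (saw-zero (trans (m%n%n≡m%n a n) a%n≡0)))
    by-residue (suc r) a%n≡1+r = trans (saw-suc a%n≡1+r) (sym (saw-suc (trans (m%n%n≡m%n a n) a%n≡1+r)))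

  0%n≡0 : 0 % n ≡ 0
  0%n≡0 = m<n⇒m%n≡m (>-nonZero⁻¹ n)

  saw-0 : saw 0 n ≡ 0ℚ
  saw-0 = saw-zero 0%n≡0

  saw-n : saw n n ≡ 0ℚ
  saw-n = saw-zero (n%n≡0 n)

  ½saw² : ℕ → ℚ
  ½saw² x = ½ ℚ.* (saw x n ℚ.* saw x n)

  ½[saw-saw]²-pos : ∀ {a b} → 0 < a → a < n → 0 < b → b < n →
                    ½ ℚ.* ((saw a n ℚ.- saw b n) ℚ.* (saw a n ℚ.- saw b n)) ≡ fromℕ (∣ a - b ∣ ²) ℚ.* ½w²
  ½[saw-saw]²-pos {a@(suc _)} {b@(suc _)} _ a<n _ b<n = begin
    ½ ℚ.* ((saw a n ℚ.- saw b n) ℚ.* (saw a n ℚ.- saw b n))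
      ≡⟨ cong₂ (λ x y → ½ ℚ.* ((x ℚ.- y) ℚ.* (x ℚ.- y))) (saw-suc (m<n⇒m%n≡m a<n)) (saw-suc (m<n⇒m%n≡m b<n)) ⟩
    ½ ℚ.* ((A ℚ.* w ℚ.- ½ ℚ.- (B ℚ.* w ℚ.- ½)) ℚ.* (A ℚ.* w ℚ.- ½ ℚ.- (B ℚ.* w ℚ.- ½)))
      ≡⟨ scale ½ ½ A B w ⟩
    (A ℚ.- B) ℚ.* (A ℚ.- B) ℚ.* ½w²
      ≡⟨ cong (ℚ._* ½w²) (fromℕ-∣-∣² a b) ⟩
    fromℕ (∣ a - b ∣ ²) ℚ.* ½w²
      ∎
    where
    open ≡-Reasoning
    A = fromℕ a
    B = fromℕ b
    scale : ∀ h H A B w → h ℚ.* ((A ℚ.* w ℚ.- H ℚ.- (B ℚ.* w ℚ.- H)) ℚ.* (A ℚ.* w ℚ.- H ℚ.- (B ℚ.* w ℚ.- H)))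
                          ≡ (A ℚ.- B) ℚ.* (A ℚ.- B) ℚ.* (h ℚ.* (w ℚ.* w))
    scale = solve 5 (λ h H A B w → h :* ((A :* w :- H :- (B :* w :- H)) :* (A :* w :- H :- (B :* w :- H)))
                                   := (A :- B) :* (A :- B) :* (h :* (w :* w))) refl
      where open +-*-Solver

  ½[saw-saw]²-residue : ∀ m {j} → gcd m n ≡ 1 → j < n →
    ½ ℚ.* ((saw j n ℚ.- saw ((m * j) % n) n) ℚ.* (saw j n ℚ.- saw ((m * j) % n) n))
      ≡ fromℕ (∣ j - (m * j) % n ∣ ²) ℚ.* ½w²
  ½[saw-saw]²-residue m {zero} _ _ =
    subst (λ s → ½ ℚ.* ((saw 0 n ℚ.- saw s n) ℚ.* (saw 0 n ℚ.- saw s n)) ≡ fromℕ (∣ 0 - s ∣ ²) ℚ.* ½w²)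
          (sym (trans (cong (_% n) (*-zeroʳ m)) 0%n≡0))
          (trans (cong (λ x → ½ ℚ.* ((x ℚ.- x) ℚ.* (x ℚ.- x))) saw-0) (sym (ℚP.*-zeroˡ ½w²)))
  ½[saw-saw]²-residue m {j@(suc _)} gcd≡1 j<n with (m * j) % n in s≡ | m%n<n (m * j) n
  ... | zero  | _   = contradiction (∣⇒≤ n∣j) (<⇒≱ j<n)
    where
    n∣j : n ∣ j
    n∣j = coprime-divisor (Coprimality.sym (gcd≡1⇒coprime {m} {n} gcd≡1)) (m%n≡0⇒n∣m (m * j) n s≡)
  ... | suc _ | s<n = ½[saw-saw]²-pos z<s j<n z<s s<n

  saw-product : ∀ m {j} → gcd m n ≡ 1 → j < n →
    saw j n ℚ.* saw (m * j) n ℚ.+ fromℕ (∣ j - (m * j) % n ∣ ²) ℚ.* ½w² ≡ ½saw² j ℚ.+ ½saw² ((m * j) % n)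
  saw-product m {j} gcd≡1 j<n = begin
    saw j n ℚ.* saw (m * j) n ℚ.+ fromℕ (∣ j - (m * j) % n ∣ ²) ℚ.* ½w²
      ≡⟨ cong₂ (λ y e → saw j n ℚ.* y ℚ.+ e) (saw-% (m * j)) (sym (½[saw-saw]²-residue m gcd≡1 j<n)) ⟩
    saw j n ℚ.* saw s n ℚ.+ ½ ℚ.* ((saw j n ℚ.- saw s n) ℚ.* (saw j n ℚ.- saw s n))
      ≡⟨ polarise (saw j n) (saw s n) ⟩
    ½saw² j ℚ.+ ½saw² s
      ∎
    where
    open ≡-Reasoning
    s = (m * j) % n
    polarise : ∀ x y → x ℚ.* y ℚ.+ ½ ℚ.* ((x ℚ.- y) ℚ.* (x ℚ.- y)) ≡ ½ ℚ.* (x ℚ.* x) ℚ.+ ½ ℚ.* (y ℚ.* y)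
    polarise = solve 2 (λ x y → x :* y :+ con ½ :* ((x :- y) :* (x :- y))
                               := con ½ :* (x :* x) :+ con ½ :* (y :* y)) refl
      where open +-*-Solver

  dedekind≡∑ : ∀ m → dedekind m n ≡ ℚ∑.∑ n (λ j → saw j n ℚ.* saw (m * j) n)
  dedekind≡∑ m =
    trans (ℚ∑.∑-upTo n (term ∘ suc)) (ℚ∑.∑-rotate n term (trans (vanishes saw-n) (sym (vanishes saw-0))))
    where
    term : ℕ → ℚ
    term j = saw j n ℚ.* saw (m * j) n
    vanishes : ∀ {j} → saw j n ≡ 0ℚ → term j ≡ 0ℚ
    vanishes {j} saw≡0 = trans (cong (ℚ._* saw (m * j) n) saw≡0) (ℚP.*-zeroˡ (saw (m * j) n))

  dedekind+displacement : ∀ m → gcd m n ≡ 1 →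
                          dedekind m n ℚ.+ fromℕ (displacement m n) ℚ.* ½w² ≡ ℚ∑.∑ n ½saw² ℚ.+ ℚ∑.∑ n ½saw²
  dedekind+displacement m gcd≡1 = begin
    dedekind m n ℚ.+ fromℕ (displacement m n) ℚ.* ½w²
      ≡⟨ cong₂ ℚ._+_ (dedekind≡∑ m) (sym (fromℕ-∑ n (λ j → ∣ j - (m * j) % n ∣ ²) ½w²)) ⟩
    ℚ∑.∑ n (λ j → saw j n ℚ.* saw (m * j) n) ℚ.+ ℚ∑.∑ n (λ j → fromℕ (∣ j - (m * j) % n ∣ ²) ℚ.* ½w²)
      ≡⟨ ℚ∑.∑-∙ n _ _ ⟨
    ℚ∑.∑ n (λ j → saw j n ℚ.* saw (m * j) n ℚ.+ fromℕ (∣ j - (m * j) % n ∣ ²) ℚ.* ½w²)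
      ≡⟨ ℚ∑.∑-cong n (λ j j<n → saw-product m gcd≡1 j<n) ⟩
    ℚ∑.∑ n (λ j → ½saw² j ℚ.+ ½saw² ((m * j) % n))
      ≡⟨ ℚ∑.∑-∙ n ½saw² (λ j → ½saw² ((m * j) % n)) ⟩
    ℚ∑.∑ n ½saw² ℚ.+ ℚ∑.∑ n (λ j → ½saw² ((m * j) % n))
      ≡⟨ cong (ℚ∑.∑ n ½saw² ℚ.+_) (ℚ∑.∑-*%-permute n m ½saw² gcd≡1) ⟩
    ℚ∑.∑ n ½saw² ℚ.+ ℚ∑.∑ n ½saw²
      ∎
    where open ≡-Reasoning

  dedekind-antitone : ∀ {m m′} → gcd m n ≡ 1 → gcd m′ n ≡ 1 →
                      displacement m′ n < displacement m n → dedekind m n <ℚ dedekind m′ n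
  dedekind-antitone {m} {m′} gcd[m,n]≡1 gcd[m′,n]≡1 D′<D = begin-strict
    dedekind m n          ≡⟨ solved-for (dedekind+displacement m gcd[m,n]≡1) ⟩
    T ℚ.- x m             <⟨ ℚP.+-monoʳ-< T (ℚP.neg-antimono-< (ℚP.*-monoˡ-<-pos ½w² {{½w²-pos}} (fromℕ-< D′<D))) ⟩
    T ℚ.- x m′            ≡⟨ solved-for (dedekind+displacement m′ gcd[m′,n]≡1) ⟨
    dedekind m′ n         ∎
    where
    open ℚP.≤-Reasoning
    T = ℚ∑.∑ n ½saw² ℚ.+ ℚ∑.∑ n ½saw²
    x : ℕ → ℚ
    x k = fromℕ (displacement k n) ℚ.* ½w²
    w-pos : ℚ.Positive w
    w-pos = ℚP.normalize-pos 1 n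
    ½w²-pos : ℚ.Positive ½w²
    ½w²-pos = ℚP.pos*pos⇒pos ½ (w ℚ.* w) {{ℚP.pos*pos⇒pos w {{w-pos}} w {{w-pos}}}}
    solved-for : ∀ {a b c} → a ℚ.+ b ≡ c → a ≡ c ℚ.- b
    solved-for {a} {b} refl = subtract a b
      where
      subtract : ∀ a b → a ≡ a ℚ.+ b ℚ.- b
      subtract = solve 2 (λ a b → a := a :+ b :- b) refl
        where open +-*-Solver

gcd[2,n]≡1 : ∀ {n} → 2 ∤ n → gcd 2 n ≡ 1
gcd[2,n]≡1 {n} 2∤n = coprime⇒gcd≡1 coprime
  where
  coprime : Coprimality.Coprime 2 n
  coprime {zero}              (0∣2 , _) = contradiction (0∣⇒≡0 0∣2) (λ ())
  coprime {suc zero}          _         = refl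
  coprime {suc (suc zero)}    (_ , 2∣n) = contradiction 2∣n 2∤n
  coprime {suc (suc (suc _))} (i∣2 , _) = contradiction (∣⇒≤ i∣2) (<⇒≱ (s≤s (s≤s (s≤s z≤n))))

theorem2 : (n : ℕ) → .{{_ : NonZero n}} → 3 ≤ n → 2 ∤ n →
    (m : ℕ) → 3 ≤ m → m < n → gcd m n ≡ 1 → m + m ≢ n + 1 →
    S m n <ℚ S 2 n
theorem2 n _ n-odd m 3≤m m<n gcd[m,n]≡1 m+m≢n+1 =
  ℚP.*-monoʳ-<-pos (ℤ.+ 12 ℚ./ 1)
    (dedekind-antitone n {m} {2} gcd[m,n]≡1 (gcd[2,n]≡1 n-odd)
      (displacement-2<displacement n m n-odd 3≤m m<n gcd[m,n]≡1 m+m≢n+1))
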